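{- Let $Y_n$ be the number of summands in the Kentucky-2 legal decomposition of an integer chosen uniformly at random from $[0,a_{2n+1})\cap\mathbb{Z}$. The variance $\sigma_n^2$ of $Y_n$ satisfies \[ \sigma_n^2=\frac{2n}{27}+\frac{8}{81}+O\!\left(\frac{n^2}{2^n}\right). \]
   Context: The Kentucky-2 sequence $(a_n)_{n\ge1}$: index $\ell$ belongs to bin $\lceil \ell/2\rceil$. A legal decomposition of $m\ge0$ using $\{a_1,\dots,a_N\}$ is $m=a_{\ell_1}+\cdots+a_{\ell_k}$, $k\ge0$, $1\le\ell_1<\cdots<\ell_k\le N$, with $\lceil \ell_{j+1}/2\rceil-\lceil \ell_j/2\rceil\ge2$ for all $j$. The sequence is defined by $a_1=1$ and, for $N\ge1$, $a_{N+1}$ is the smallest positive integer with no legal decomposition using $\{a_1,\dots,a_N\}$ (first terms $1,2,3,4,5,8,11,16,\dots$). Every nonnegative integer has a unique legal decomposition (that of $0$ has $0$ summands). -}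

module Defs where

open import Data.Nat using (ℕ; zero; suc; _+_; _*_; _^_; _≤_; _<_; ⌈_/2⌉)
open import Data.Integer using (+_)
open import Data.Rational using (ℚ; _/_; 0ℚ) renaming (_+_ to _+ℚ_; _*_ to _*ℚ_; _-_ to _-ℚ_)
open import Data.List using (List; []; _∷_; map; length; upTo)
open import Data.Nat.ListAction using (sum)
open import Data.List.Relation.Unary.All using (All)
open import Data.Product using (Σ; ∃; _×_)
open import Data.Unit using (⊤)
open import Relation.Nullary using (¬_)
open import Relation.Binary.PropositionalEquality using (_≡_)

bin : ℕ → ℕ
bin ℓ = ⌈ ℓ /2⌉

BinChain : ℕ → List ℕ → Set
BinChain x [] = ⊤
BinChain x (y ∷ ys) = (2 + bin x ≤ bin y) × BinChain y ys

-- an index list ℓ₁, ℓ₂, … , ℓₖ (k ≥ 0) with 1 ≤ ℓ₁ and the bin-gap condition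
-- (which forces ℓ₁ < ℓ₂ < … < ℓₖ)
LegalIndices : List ℕ → Set
LegalIndices [] = ⊤
LegalIndices (x ∷ xs) = (1 ≤ x) × BinChain x xs

LegalDecUsing : (ℕ → ℕ) → ℕ → ℕ → List ℕ → Set
LegalDecUsing a N m ℓs = LegalIndices ℓs × All (λ ℓ → ℓ ≤ N) ℓs × (sum (map a ℓs) ≡ m)

HasLegalDecUsing : (ℕ → ℕ) → ℕ → ℕ → Set
HasLegalDecUsing a N m = ∃ λ ℓs → LegalDecUsing a N m ℓs

-- a is the Kentucky-2 sequence (a 0 is irrelevant/unused):
-- a₁ = 1, and for N ≥ 1, a_{N+1} is the smallest positive integer with
-- no legal decomposition using {a₁,…,a_N}.
IsKentucky2 : (ℕ → ℕ) → Set
IsKentucky2 a =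
  (a 1 ≡ 1) ×
  (∀ N → 1 ≤ N →
     (1 ≤ a (suc N)) ×
     ¬ HasLegalDecUsing a N (a (suc N)) ×
     (∀ m → 1 ≤ m → m < a (suc N) → HasLegalDecUsing a N m))

-- k is the number of summands of a legal decomposition of m (with respect to
-- the whole sequence; such a decomposition exists and is unique)
NumSummands : (ℕ → ℕ) → ℕ → ℕ → Set
NumSummands a m k = ∃ λ ℓs → LegalIndices ℓs × (sum (map a ℓs) ≡ m) × (length ℓs ≡ k)

ℕ→ℚ : ℕ → ℚ
ℕ→ℚ n = (+ n) / 1

-- division of a rational by a natural (only used with positive divisor)
_÷_ : ℚ → ℕ → ℚ
p ÷ zero = 0ℚ
p ÷ suc k = p *ℚ ((+ 1) / suc k)

-- mean of a list of naturals (uniform distribution on the list entries)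
mean : List ℕ → ℚ
mean xs = ℕ→ℚ (sum xs) ÷ length xs

variance : List ℕ → ℚ
variance xs = mean (map (λ x → x * x) xs) -ℚ (mean xs *ℚ mean xs)

sigma2 : (ℕ → ℕ) → (ℕ → ℕ) → ℕ → ℚ
sigma2 a Y n = variance (map Y (upTo (a (suc (2 * n)))))

module Submission where

-- With J₀ = J₁ = 1, J_{k+2} = J_{k+1} + 2 J_k, the sequence
--    ky_{2k+1} = J_{k+1}, ky_{2k+2} = J_{k+1} + J_k obeys ky_{y+1} = ky_y + ky_{cap y + 1},
--    where cap y is the largest index allowed below y.  Hence descending legal lists with
--    top index ≤ N are worth less than ky_{N+1}, greedy decompositions exist, and they are
--    unique; so ky satisfies the defining property, which determines the sequence: a = ky.
-- 2. SummandCounts.  Putting index 2k+1 or 2k+2 on top of a decomposition of r < J_k gives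
--    Y(J_{k+1} + r) = Y(J_{k+1} + J_k + r) = Y(r) + 1.
-- 3. Moments / ClosedForms.  Splitting [0, J_{k+2}) into [0, J_{k+1}) and two shifted copies
--    of [0, J_k) gives two-step recurrences for Σ Y and Σ Y² over [0, J_k); their solutions
--    are pinned down by closed forms in k, 2^k and (−1)^k.
-- 4. NumeratorBound / VarianceFraction.  Over the denominator 243 J_{n+1}², the difference
--    σ²_n − (2n/27 + 8/81) has numerator −(8 + 4n + (−1)ⁿ 2ⁿ (16 + 32n + 12n²)), which is
--    at most n² 2^{-n} · 243 J_{n+1}² in absolute value since J_{n+1} ≥ 2ⁿ.

open import Defs using (IsKentucky2; NumSummands)
open import Data.Nat using (ℕ)
open import Relation.Binary.PropositionalEquality using (_≡_)

module KentuckySequence where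
  open import Defs using (bin)
  open import Data.Nat
    using (ℕ; zero; suc; _+_; _*_; _∸_; _^_; _≤_; _<_; z≤n; s≤s; ⌊_/2⌋; _≤′_; ≤′-refl; ≤′-step)
  open import Data.Nat.Properties
  open import Data.Product using (_×_)
  open import Data.Empty using (⊥-elim)
  open import Function using (_∘_)
  open import Relation.Binary.Definitions using (tri<; tri≈; tri>)
  open import Relation.Binary.PropositionalEquality hiding (J)

  -- J₀ = J₁ = 1, J_{k+2} = J_{k+1} + 2·J_k  (1, 1, 3, 5, 11, 21, …): the first
  -- element of bin k is J_k, and a_{2n+1} = J_{n+1}.
  J : ℕ → ℕ
  J zero = 1
  J (suc zero) = 1
  J (suc (suc k)) = J (suc k) + 2 * J k

  J-pos : ∀ k → 1 ≤ J k
  J-pos zero = s≤s z≤n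
  J-pos (suc zero) = s≤s z≤n
  J-pos (suc (suc k)) = ≤-trans (J-pos (suc k)) (m≤m+n _ _)

  -- J₁ = J₀ lets us treat bin 0 as a copy of bin 1
  J-pred : ∀ k → J (suc (k ∸ 1)) ≡ J k
  J-pred zero = refl
  J-pred (suc k) = refl

  J-lower : ∀ k → 2 ^ k ≤ J (suc k)
  J-lower zero = s≤s z≤n
  J-lower (suc zero) = s≤s (s≤s z≤n)
  J-lower (suc (suc k)) = ≤-trans (≤-reflexive (cong (2 ^ suc k +_) (*-identityˡ (2 ^ suc k))))
                                  (+-mono-≤ (J-lower (suc k)) (*-monoʳ-≤ 2 (J-lower k)))

  -- 2k, by a recursion that exposes the parity of 2k + 1 and 2k + 2
  double : ℕ → ℕ
  double zero = zero
  double (suc k) = suc (suc (double k))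

  double-mono : ∀ {m n} → m ≤ n → double m ≤ double n
  double-mono z≤n = z≤n
  double-mono (s≤s m≤n) = s≤s (s≤s (double-mono m≤n))

  double≡2* : ∀ n → double n ≡ 2 * n
  double≡2* zero = refl
  double≡2* (suc n) = cong suc (trans (cong suc (double≡2* n)) (sym (+-suc n (n + 0))))

  -- Index 2k+1 is the first and index 2k+2 the second element of bin k+1.
  data Parity : ℕ → Set where
    even : ∀ k → Parity (double k)
    odd  : ∀ k → Parity (suc (double k))

  parity : ∀ n → Parity n
  parity zero = even zero
  parity (suc n) with parity n
  ... | even k = odd k
  ... | odd k = even (suc k)

  parity-even : ∀ k → parity (double k) ≡ even k
  parity-even zero = refl
  parity-even (suc k) rewrite parity-even k = refl

  parity-odd : ∀ k → parity (suc (double k)) ≡ odd k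
  parity-odd k rewrite parity-even k = refl

  index-ind : (P : ℕ → Set) → (∀ k → P (suc (double k))) → (∀ k → P (suc (suc (double k)))) →
              ∀ ℓ → P (suc ℓ)
  index-ind P first second ℓ with parity ℓ
  ... | even k = first k
  ... | odd k = second k

  kyAt : ∀ {ℓ} → Parity ℓ → ℕ
  kyAt (even k) = J (suc k)
  kyAt (odd k) = J (suc k) + J k

  ky : ℕ → ℕ
  ky zero = 0
  ky (suc ℓ) = kyAt (parity ℓ)

  ky-first : ∀ k → ky (suc (double k)) ≡ J (suc k)
  ky-first k = cong kyAt (parity-even k)

  ky-second : ∀ k → ky (suc (suc (double k))) ≡ J (suc k) + J k
  ky-second k = cong kyAt (parity-odd k)

  ky-pos : ∀ ℓ → 1 ≤ ky (suc ℓ)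
  ky-pos = index-ind (λ y → 1 ≤ ky y)
    (λ k → subst (1 ≤_) (sym (ky-first k)) (J-pos (suc k)))
    (λ k → subst (1 ≤_) (sym (ky-second k)) (≤-trans (J-pos (suc k)) (m≤m+n _ _)))

  half-double : ∀ k → ⌊ double k /2⌋ ≡ k
  half-double zero = refl
  half-double (suc k) = cong suc (half-double k)

  half-suc-double : ∀ k → ⌊ suc (double k) /2⌋ ≡ k
  half-suc-double zero = refl
  half-suc-double (suc k) = cong suc (half-suc-double k)

  bin-first : ∀ k → bin (suc (double k)) ≡ suc k
  bin-first k = cong suc (half-double k)

  bin-second : ∀ k → bin (suc (suc (double k))) ≡ suc k
  bin-second k = cong suc (half-suc-double k)

  bin-double : ∀ k → bin (double k) ≡ k
  bin-double = half-suc-double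

  ≤double-bin : ∀ ℓ → ℓ ≤ double (bin ℓ)
  ≤double-bin zero = z≤n
  ≤double-bin (suc zero) = s≤s z≤n
  ≤double-bin (suc (suc ℓ)) = s≤s (s≤s (≤double-bin ℓ))

  bin-pos : ∀ {ℓ} → 1 ≤ ℓ → 1 ≤ bin ℓ
  bin-pos 1≤ℓ = ⌈n/2⌉-mono 1≤ℓ

  pos-of-bin : ∀ ℓ → 1 ≤ bin ℓ → 1 ≤ ℓ
  pos-of-bin (suc ℓ) _ = s≤s z≤n

  -- cap y is the largest index that may follow y in a legal decomposition
  -- listed from the top: the top index of the bin two below that of y
  cap : ℕ → ℕ
  cap y = double (bin y ∸ 2)

  cap-first : ∀ k → cap (suc (double k)) ≡ double (k ∸ 1)
  cap-first k = cong (λ b → double (b ∸ 2)) (bin-first k)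

  cap-second : ∀ k → cap (suc (suc (double k))) ≡ double (k ∸ 1)
  cap-second k = cong (λ b → double (b ∸ 2)) (bin-second k)

  cap< : ∀ y → 1 ≤ y → cap y < y
  cap< (suc ℓ) _ = index-ind (λ y → cap y < y)
    (λ k → subst (_< suc (double k)) (sym (cap-first k)) (s≤s (double-mono (m∸n≤m k 1))))
    (λ k → subst (_< suc (suc (double k))) (sym (cap-second k))
                 (s≤s (≤-trans (double-mono (m∸n≤m k 1)) (n≤1+n _))))
    ℓ

  private
    gap-of-∸ : ∀ {b} c → 1 ≤ b → b ≤ c ∸ 2 → 2 + b ≤ c
    gap-of-∸ zero (s≤s z≤n) ()
    gap-of-∸ (suc zero) (s≤s z≤n) ()
    gap-of-∸ (suc (suc c)) _ b≤c = s≤s (s≤s b≤c)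

  ≤cap⇒gap : ∀ {x y} → 1 ≤ x → x ≤ cap y → 2 + bin x ≤ bin y
  ≤cap⇒gap {x} {y} 1≤x x≤cap = gap-of-∸ (bin y) (bin-pos 1≤x)
    (subst (bin x ≤_) (bin-double (bin y ∸ 2)) (⌈n/2⌉-mono x≤cap))

  gap⇒≤cap : ∀ {x y} → 2 + bin x ≤ bin y → x ≤ cap y
  gap⇒≤cap {x} {y} gap = ≤-trans (≤double-bin x) (double-mono (∸-monoˡ-≤ 2 gap))

  ky-below-first : ∀ k → ky (suc (cap (suc (double k)))) ≡ J k
  ky-below-first k = trans (cong (ky ∘ suc) (cap-first k)) (trans (ky-first (k ∸ 1)) (J-pred k))

  ky-below-second : ∀ k → ky (suc (cap (suc (suc (double k))))) ≡ J k
  ky-below-second k = trans (cong (ky ∘ suc) (cap-second k)) (trans (ky-first (k ∸ 1)) (J-pred k))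

  -- The recurrence behind greedy decompositions: ky_{y+1} = ky_y + ky_{cap y + 1}.
  ky-rec : ∀ y → 1 ≤ y → ky (suc y) ≡ ky y + ky (suc (cap y))
  ky-rec (suc ℓ) _ = index-ind (λ y → ky (suc y) ≡ ky y + ky (suc (cap y)))
    (λ k → begin
      ky (suc (suc (double k)))            ≡⟨ ky-second k ⟩
      J (suc k) + J k                      ≡⟨ cong₂ _+_ (ky-first k) (ky-below-first k) ⟨
      ky (suc (double k)) + ky (suc (cap (suc (double k)))) ∎)
    (λ k → begin
      ky (suc (double (suc k)))            ≡⟨ ky-first (suc k) ⟩
      J (suc k) + (J k + (J k + 0))        ≡⟨ cong (λ t → J (suc k) + (J k + t)) (+-identityʳ (J k)) ⟩
      J (suc k) + (J k + J k)              ≡⟨ +-assoc (J (suc k)) (J k) (J k) ⟨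
      J (suc k) + J k + J k                ≡⟨ cong₂ _+_ (ky-second k) (ky-below-second k) ⟨
      ky (suc (suc (double k))) + ky (suc (cap (suc (suc (double k))))) ∎)
    ℓ
    where open ≡-Reasoning

  ky-step : ∀ y → ky y < ky (suc y)
  ky-step zero = s≤s z≤n
  ky-step (suc ℓ) = subst (ky (suc ℓ) <_) (sym (ky-rec (suc ℓ) (s≤s z≤n)))
                          (m<m+n (ky (suc ℓ)) (ky-pos (cap (suc ℓ))))

  ky-mono : ∀ {m n} → m ≤ n → ky m ≤ ky n
  ky-mono m≤n = go (≤⇒≤′ m≤n)
    where
    go : ∀ {m n} → m ≤′ n → ky m ≤ ky n
    go ≤′-refl = ≤-refl
    go (≤′-step {n} m≤′n) = ≤-trans (go m≤′n) (<⇒≤ (ky-step n))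

  ky-mono-< : ∀ {m n} → m < n → ky m < ky n
  ky-mono-< {m} m<n = <-≤-trans (ky-step m) (ky-mono m<n)

  ky-reflect-< : ∀ {m n} → ky m < ky n → m < n
  ky-reflect-< {m} {n} lt with <-cmp m n
  ... | tri< m<n _ _ = m<n
  ... | tri≈ _ refl _ = ⊥-elim (<-irrefl refl lt)
  ... | tri> _ _ n<m = ⊥-elim (<-asym lt (ky-mono-< n<m))

  SelfSimilar : (ℕ → ℕ) → Set
  SelfSimilar Y = ∀ k r → r < J k → Y (J (suc k) + r) ≡ suc (Y r) × Y (J (suc k) + (J k + r)) ≡ suc (Y r)

module Decompositions where
  open KentuckySequence
  open import Defs using (BinChain; LegalIndices; HasLegalDecUsing; IsKentucky2)
  open import Data.Nat using (ℕ; zero; suc; _+_; _∸_; _≤_; _<_; z≤n; s≤s; _<?_)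
  open import Data.Nat.Properties
  open import Data.Nat.Induction using (<-rec)
  open import Data.List using (List; []; _∷_; map; reverse; foldl)
  open import Data.Nat.ListAction using (sum)
  open import Data.Nat.ListAction.Properties using (sum-↭)
  open import Data.List.Properties using (reverse-map)
  open import Data.List.Relation.Binary.Permutation.Propositional using (↭-sym)
  open import Data.List.Relation.Binary.Permutation.Propositional.Properties using (↭-reverse; All-resp-↭)
  open import Data.List.Relation.Unary.All as All using (All; []; _∷_)
  open import Data.Product using (∃; _×_; _,_; proj₁)
  open import Data.Unit using (tt)
  open import Data.Empty using (⊥-elim)
  open import Function using (flip)
  open import Relation.Nullary using (¬_; yes; no)
  open import Relation.Binary.Definitions using (tri<; tri≈; tri>)
  open import Relation.Binary.PropositionalEquality hiding (J)

  value : List ℕ → ℕ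
  value ds = sum (map ky ds)

  -- Desc N ds: a legal decomposition listed from its largest index down, all indices in [1, N]
  data Desc : ℕ → List ℕ → Set where
    []   : ∀ {N} → Desc N []
    cons : ∀ {N y ys} → 1 ≤ y → y ≤ N → Desc (cap y) ys → Desc N (y ∷ ys)

  desc-weaken : ∀ {N M ds} → N ≤ M → Desc N ds → Desc M ds
  desc-weaken N≤M [] = []
  desc-weaken N≤M (cons 1≤y y≤N d) = cons 1≤y (≤-trans y≤N N≤M) d

  value< : ∀ {N ds} → Desc N ds → value ds < ky (suc N)
  value< {N} [] = ≤-trans (ky-pos 0) (ky-mono {1} {suc N} (s≤s z≤n))
  value< {N} (cons {y = y} {ys} 1≤y y≤N d) = begin-strict
    ky y + value ys             <⟨ +-monoʳ-< (ky y) (value< d) ⟩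
    ky y + ky (suc (cap y))     ≡⟨ ky-rec y 1≤y ⟨
    ky (suc y)                  ≤⟨ ky-mono (s≤s y≤N) ⟩
    ky (suc N)                  ∎
    where open ≤-Reasoning

  desc-rebound : ∀ {N M ds} → Desc N ds → value ds < ky (suc M) → Desc M ds
  desc-rebound [] _ = []
  desc-rebound (cons {y = y} 1≤y _ d) v< =
    cons 1≤y (≤-pred (ky-reflect-< (≤-<-trans (m≤m+n (ky y) _) v<))) d

  -- uniqueness: the top index is pinned down by ky_y ≤ value < ky_{y+1}
  desc-unique : ∀ {N M ds es} → Desc N ds → Desc M es → value ds ≡ value es → ds ≡ es
  desc-unique [] [] _ = refl
  desc-unique [] (cons {y = suc y} _ _ _) eq = ⊥-elim (<⇒≢ (≤-trans (ky-pos y) (m≤m+n _ _)) eq)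
  desc-unique (cons {y = suc y} _ _ _) [] eq = ⊥-elim (<⇒≢ (≤-trans (ky-pos y) (m≤m+n _ _)) (sym eq))
  desc-unique (cons {y = y} {ys} 1≤y _ d) (cons {y = z} {zs} 1≤z _ e) eq with <-cmp y z
  ... | tri< y<z _ _ = ⊥-elim (<⇒≢ (<-≤-trans (value< (cons 1≤y ≤-refl d))
                                     (≤-trans (ky-mono y<z) (m≤m+n (ky z) (value zs)))) eq)
  ... | tri> _ _ z<y = ⊥-elim (<⇒≢ (<-≤-trans (value< (cons 1≤z ≤-refl e))
                                     (≤-trans (ky-mono z<y) (m≤m+n (ky y) (value ys)))) (sym eq))
  ... | tri≈ _ refl _ = cong (y ∷_) (desc-unique d e (+-cancelˡ-≡ (ky y) _ _ eq))

  -- greedy decomposition: take the largest index whose value fits, and recurse below its cap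
  greedy : ∀ N m → m < ky (suc N) → ∃ λ ds → Desc N ds × value ds ≡ m
  greedy = <-rec (λ N → ∀ m → m < ky (suc N) → ∃ λ ds → Desc N ds × value ds ≡ m) step
    where
    step : ∀ N → (∀ {N′} → N′ < N → ∀ m → m < ky (suc N′) → ∃ λ ds → Desc N′ ds × value ds ≡ m) →
           ∀ m → m < ky (suc N) → ∃ λ ds → Desc N ds × value ds ≡ m
    step zero _ zero _ = [] , [] , refl
    step zero _ (suc m) (s≤s ())
    step (suc N) ih m m< with m <? ky (suc N)
    ... | yes m<top with ih {N} ≤-refl m m<top
    ...   | ds , d , v = ds , desc-weaken (n≤1+n N) d , v
    step (suc N) ih m m< | no m≮top with ih {cap (suc N)} (cap< (suc N) (s≤s z≤n)) (m ∸ ky (suc N)) rest<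
      where
      rest< : m ∸ ky (suc N) < ky (suc (cap (suc N)))
      rest< = +-cancelˡ-< (ky (suc N)) _ _ (subst₂ _<_ (sym (m+[n∸m]≡n (≮⇒≥ m≮top)))
                                                     (ky-rec (suc N) (s≤s z≤n)) m<)
    ... | ds , d , v = suc N ∷ ds , cons (s≤s z≤n) ≤-refl d ,
                       trans (cong (ky (suc N) +_) v) (m+[n∸m]≡n (≮⇒≥ m≮top))

  chain-pos : ∀ {x} ys → BinChain x ys → All (1 ≤_) ys
  chain-pos [] _ = []
  chain-pos (y ∷ ys) (gap , c) = pos-of-bin y (≤-trans (s≤s z≤n) gap) ∷ chain-pos ys c

  legal-pos : ∀ ℓs → LegalIndices ℓs → All (1 ≤_) ℓs
  legal-pos [] _ = []
  legal-pos (x ∷ xs) (1≤x , c) = 1≤x ∷ chain-pos xs c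

  -- Reversal turns legal (increasing) decompositions into descending ones and back.
  -- (reverse (x ∷ xs) unfolds to foldl (flip _∷_) (x ∷ []) xs, whence the accumulators.)
  chain→desc : ∀ {N x acc} xs → 1 ≤ x → BinChain x xs → Desc (cap x) acc → All (_≤ N) (x ∷ xs) →
               Desc N (foldl (flip _∷_) (x ∷ acc) xs)
  chain→desc [] 1≤x _ d (x≤N ∷ []) = cons 1≤x x≤N d
  chain→desc (y ∷ ys) 1≤x (gap , c) d (_ ∷ bounds) =
    chain→desc ys (pos-of-bin y (≤-trans (s≤s z≤n) gap)) c (cons 1≤x (gap⇒≤cap gap) d) bounds

  legal→desc : ∀ {N ℓs} → LegalIndices ℓs → All (_≤ N) ℓs → Desc N (reverse ℓs)
  legal→desc {ℓs = []} _ _ = []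
  legal→desc {ℓs = x ∷ xs} (1≤x , c) bounds = chain→desc xs 1≤x c [] bounds

  desc→chain : ∀ {y acc} zs → LegalIndices (y ∷ acc) → Desc (cap y) zs →
               LegalIndices (foldl (flip _∷_) (y ∷ acc) zs)
  desc→chain [] legal _ = legal
  desc→chain (z ∷ zs) (_ , c) (cons 1≤z z≤cap d) = desc→chain zs (1≤z , ≤cap⇒gap 1≤z z≤cap , c) d

  desc→legal : ∀ {N ds} → Desc N ds → LegalIndices (reverse ds)
  desc→legal [] = tt
  desc→legal (cons {ys = ys} 1≤y _ d) = desc→chain ys (1≤y , tt) d

  desc-bounded : ∀ {N ds} → Desc N ds → All (_≤ N) ds
  desc-bounded [] = []
  desc-bounded (cons {y = y} 1≤y y≤N d) =
    y≤N ∷ All.map (λ z≤cap → ≤-trans z≤cap (≤-trans (<⇒≤ (cap< y 1≤y)) y≤N)) (desc-bounded d)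

  value-reverse : ∀ ds → value (reverse ds) ≡ value ds
  value-reverse ds = trans (cong sum (reverse-map ky ds)) (sum-↭ (↭-reverse (map ky ds)))

  all-reverse : ∀ {P : ℕ → Set} {ds} → All P ds → All P (reverse ds)
  all-reverse {ds = ds} = All-resp-↭ (↭-sym (↭-reverse ds))

  ky-kentucky : IsKentucky2 ky
  ky-kentucky = refl , λ N _ → ky-pos N , not-representable N , representable N
    where
    not-representable : ∀ N → ¬ HasLegalDecUsing ky N (ky (suc N))
    not-representable N (ℓs , legal , bounds , v) =
      <⇒≢ (subst (_< ky (suc N)) (value-reverse ℓs) (value< (legal→desc legal bounds))) v
    representable : ∀ N m → 1 ≤ m → m < ky (suc N) → HasLegalDecUsing ky N m
    representable N m _ m< with greedy N m m<
    ... | ds , d , v = reverse ds , desc→legal d , all-reverse (desc-bounded d) , trans (value-reverse ds) v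

  sum-map-cong : ∀ {f g : ℕ → ℕ} {xs} → All (λ x → f x ≡ g x) xs → sum (map f xs) ≡ sum (map g xs)
  sum-map-cong [] = refl
  sum-map-cong (e ∷ es) = cong₂ _+_ e (sum-map-cong es)

  Agree : (ℕ → ℕ) → (ℕ → ℕ) → ℕ → Set
  Agree a b N = ∀ i → 1 ≤ i → i ≤ N → a i ≡ b i

  -- a decomposition with indices ≤ N only involves the first N terms
  transfer : ∀ {a b N m} → Agree a b N → HasLegalDecUsing b N m → HasLegalDecUsing a N m
  transfer agree (ℓs , legal , bounds , v) = ℓs , legal , bounds ,
    trans (sum-map-cong (All.zipWith (λ (1≤i , i≤N) → agree _ 1≤i i≤N) (legal-pos ℓs legal , bounds))) v

  -- If two Kentucky-2 sequences agree up to N, then a_{N+1} < b_{N+1} is impossible: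
  -- a_{N+1} would have a decomposition by b's defining property, hence one using a.
  not-below : ∀ {a b N} → IsKentucky2 a → IsKentucky2 b → 1 ≤ N → Agree a b N → ¬ (a (suc N) < b (suc N))
  not-below {N = N} (_ , Ka) (_ , Kb) 1≤N agree a<b with Ka N 1≤N | Kb N 1≤N
  ... | a-pos , a-new , _ | _ , _ , b-covers = a-new (transfer agree (b-covers _ a-pos a<b))

  kentucky-unique : ∀ {a b} → IsKentucky2 a → IsKentucky2 b → ∀ i → 1 ≤ i → a i ≡ b i
  kentucky-unique {a} {b} Ka Kb = <-rec (λ i → 1 ≤ i → a i ≡ b i) step
    where
    step : ∀ i → (∀ {j} → j < i → 1 ≤ j → a j ≡ b j) → 1 ≤ i → a i ≡ b i
    step (suc zero) _ _ = trans (proj₁ Ka) (sym (proj₁ Kb))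
    step (suc (suc N)) ih _ with <-cmp (a (suc (suc N))) (b (suc (suc N)))
    ... | tri< a<b _ _ = ⊥-elim (not-below Ka Kb (s≤s z≤n) (λ i 1≤i i≤ → ih (s≤s i≤) 1≤i) a<b)
    ... | tri≈ _ a≡b _ = a≡b
    ... | tri> _ _ b<a = ⊥-elim (not-below Kb Ka (s≤s z≤n) (λ i 1≤i i≤ → sym (ih (s≤s i≤) 1≤i)) b<a)

module SummandCounts (a : ℕ → ℕ) (K : IsKentucky2 a) (Y : ℕ → ℕ) (hY : ∀ m → NumSummands a m (Y m)) where
  open KentuckySequence
  open Decompositions
  open import Data.Nat using (ℕ; suc; _+_; _*_; _≤_; _<_; z≤n; s≤s)
  open import Data.Nat.Properties using (≤-refl; ≤-trans; m≤m+n; m≤n+m; +-assoc)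
  open import Data.List using ([]; _∷_; length; reverse)
  open import Data.List.Properties using (length-reverse)
  open import Data.Nat.ListAction using (sum)
  open import Data.List.Relation.Unary.All as All using (All; []; _∷_)
  open import Data.Product using (∃₂; _×_; _,_)
  open import Function using (_∘_)
  open import Relation.Binary.PropositionalEquality using (_≡_; refl; sym; trans; cong; subst)

  a≡ky : ∀ i → 1 ≤ i → a i ≡ ky i
  a≡ky = kentucky-unique K ky-kentucky

  -- a crude bound on the entries of a list, to put a legal decomposition into Desc form
  all-≤-sum : ∀ xs → All (_≤ sum xs) xs
  all-≤-sum [] = []
  all-≤-sum (x ∷ xs) = m≤m+n x (sum xs) ∷ All.map (λ y≤ → ≤-trans y≤ (m≤n+m (sum xs) x)) (all-≤-sum xs)

  top-down : ∀ m → ∃₂ λ N ds → Desc N ds × value ds ≡ m × length ds ≡ Y m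
  top-down m with hY m
  ... | ℓs , legal , v , len =
    sum ℓs , reverse ℓs , legal→desc legal (all-≤-sum ℓs) ,
    trans (value-reverse ℓs) (trans (sym (sum-map-cong (All.map (a≡ky _) (legal-pos ℓs legal)))) v) ,
    trans (length-reverse ℓs) len

  count : ∀ {N ds} m → Desc N ds → value ds ≡ m → length ds ≡ Y m
  count m d v with top-down m
  ... | _ , es , e , v′ , len = trans (cong length (desc-unique d e (trans v (sym v′)))) len

  Y-zero : Y 0 ≡ 0
  Y-zero = sym (count {N = 0} 0 [] refl)

  Y-shift : ∀ y r → 1 ≤ y → r < ky (suc (cap y)) → Y (ky y + r) ≡ suc (Y r)
  Y-shift y r 1≤y r< with top-down r
  ... | _ , ds , d , v , len =
    trans (sym (count (ky y + r) (cons 1≤y ≤-refl (desc-rebound d (subst (_< _) (sym v) r<)))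
                                 (cong (ky y +_) v)))
          (cong suc len)

  -- with y = 2k + 1 and y = 2k + 2, whose cap leaves room for exactly [0, J_k)
  Y-self-similar : SelfSimilar Y
  Y-self-similar k r r< = first , second
    where
    first : Y (J (suc k) + r) ≡ suc (Y r)
    first = subst (λ t → Y (t + r) ≡ suc (Y r)) (ky-first k)
      (Y-shift (suc (double k)) r (s≤s z≤n) (subst (r <_) (sym (ky-below-first k)) r<))
    second : Y (J (suc k) + (J k + r)) ≡ suc (Y r)
    second = subst (λ t → Y t ≡ suc (Y r))
      (trans (cong (_+ r) (ky-second k)) (+-assoc (J (suc k)) (J k) r))
      (Y-shift (suc (suc (double k))) r (s≤s z≤n) (subst (r <_) (sym (ky-below-second k)) r<))

  a-first : ∀ n → a (suc (2 * n)) ≡ J (suc n)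
  a-first n = trans (a≡ky (suc (2 * n)) (s≤s z≤n)) (trans (cong (ky ∘ suc) (sym (double≡2* n))) (ky-first n))

module RangeSums where
  open import Data.Nat using (ℕ; zero; suc; _+_; _*_; _<_; z≤n; s≤s)
  open import Data.Nat.Properties using (+-assoc)
  open import Data.Nat.Tactic.RingSolver using (solve-∀)
  open import Data.List using (applyUpTo)
  open import Data.Nat.ListAction using (sum)
  open import Function using (_∘_)
  open import Relation.Binary.PropositionalEquality using (_≡_; refl; sym; trans; cong; cong₂)

  Σ< : (ℕ → ℕ) → ℕ → ℕ
  Σ< f n = sum (applyUpTo f n)

  Σ<-split : ∀ f m n → Σ< f (m + n) ≡ Σ< f m + Σ< (λ i → f (m + i)) n
  Σ<-split f zero n = refl
  Σ<-split f (suc m) n = trans (cong (f 0 +_) (Σ<-split (f ∘ suc) m n)) (sym (+-assoc (f 0) _ _))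

  Σ<-cong : ∀ {f g} n → (∀ i → i < n → f i ≡ g i) → Σ< f n ≡ Σ< g n
  Σ<-cong zero _ = refl
  Σ<-cong (suc n) eq = cong₂ _+_ (eq 0 (s≤s z≤n)) (Σ<-cong n (λ i i< → eq (suc i) (s≤s i<)))

  Σ<-suc : ∀ f n → Σ< (suc ∘ f) n ≡ Σ< f n + n
  Σ<-suc f zero = refl
  Σ<-suc f (suc n) = trans (cong (suc (f 0) +_) (Σ<-suc (f ∘ suc) n)) (rearrange (f 0) _ n)
    where
    rearrange : ∀ x s n → suc x + (s + n) ≡ x + s + suc n
    rearrange = solve-∀

  Σ<-suc-square : ∀ f n → Σ< (λ i → suc (f i) * suc (f i)) n ≡ Σ< (λ i → f i * f i) n + 2 * Σ< f n + n
  Σ<-suc-square f zero = refl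
  Σ<-suc-square f (suc n) =
    trans (cong (suc (f 0) * suc (f 0) +_) (Σ<-suc-square (f ∘ suc) n)) (rearrange (f 0) _ _ n)
    where
    rearrange : ∀ x q s n → suc x * suc x + (q + 2 * s + n) ≡ x * x + q + 2 * (x + s) + suc n
    rearrange = solve-∀

-- Closed forms, in ℤ, for J and for the moments, via uniqueness of solutions of
-- two-step recurrences u_{k+2} = u_{k+1} + 2 u_k + g_k.
module ClosedForms where
  open KentuckySequence using (J)
  open import Data.Nat as ℕ using (ℕ; zero; suc)
  import Data.Nat.Properties as ℕP
  open import Data.Integer using (ℤ; +_; -_; _+_; _-_; _*_; _^_)
  open import Data.Integer.Properties using (pos-*; *-cancelˡ-≡)
  open import Data.Integer.Tactic.RingSolver using (solve-∀)
  open import Data.Product using (_×_; _,_; proj₁)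
  open import Data.Sum using (_⊎_; inj₁; inj₂)
  open import Relation.Binary.PropositionalEquality
    using (_≡_; refl; sym; trans; cong; cong₂; subst; module ≡-Reasoning)
  open ≡-Reasoning

  sign : ℕ → ℤ
  sign zero = + 1
  sign (suc k) = - sign k

  pow2 : ℕ → ℤ
  pow2 k = (+ 2) ^ k

  TwoStep : (ℕ → ℤ) → (ℕ → ℤ) → Set
  TwoStep g u = ∀ k → u (suc (suc k)) ≡ u (suc k) + + 2 * u k + g k

  two-step-unique : ∀ {g u v} → TwoStep g u → TwoStep g v → u 0 ≡ v 0 → u 1 ≡ v 1 → ∀ k → u k ≡ v k
  two-step-unique {g} {u} {v} rec-u rec-v e₀ e₁ k = proj₁ (agree k)
    where
    agree : ∀ k → u k ≡ v k × u (suc k) ≡ v (suc k)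
    agree zero = e₀ , e₁
    agree (suc k) with agree k
    ... | eₖ , eₖ₊₁ =
      eₖ₊₁ , trans (rec-u k) (trans (cong₂ (λ s t → s + + 2 * t + g k) eₖ₊₁ eₖ) (sym (rec-v k)))

  scaled : ∀ c {f g : ℕ → ℕ} → (∀ k → f (suc (suc k)) ≡ f (suc k) ℕ.+ 2 ℕ.* f k ℕ.+ g k) →
           TwoStep (λ k → c * + g k) (λ k → c * + f k)
  scaled c {f} {g} rec k = begin
    c * + f (suc (suc k))                            ≡⟨ cong (λ t → c * + t) (rec k) ⟩
    c * (+ f (suc k) + + (2 ℕ.* f k) + + g k)        ≡⟨ cong (λ t → c * (+ f (suc k) + t + + g k)) (pos-* 2 (f k)) ⟩
    c * (+ f (suc k) + + 2 * + f k + + g k)          ≡⟨ distribute c (+ f (suc k)) (+ f k) (+ g k) ⟩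
    c * + f (suc k) + + 2 * (c * + f k) + c * + g k  ∎
    where
    distribute : ∀ c a b d → c * (a + + 2 * b + d) ≡ c * a + + 2 * (c * b) + c * d
    distribute = solve-∀

  Jform : ℕ → ℤ
  Jform k = + 2 * pow2 k + sign k

  J-closed : ∀ k → + 3 * + J k ≡ Jform k
  J-closed = two-step-unique (scaled (+ 3) {J} {λ _ → 0} (λ k → sym (ℕP.+-identityʳ _))) Jform-rec refl refl
    where
    Jform-rec : TwoStep (λ _ → + 0) Jform
    Jform-rec k = identity (pow2 k) (sign k)
      where
      identity : ∀ x s → + 2 * (+ 2 * (+ 2 * x)) + - (- s) ≡ + 2 * (+ 2 * x) + - s + + 2 * (+ 2 * x + s) + + 0
      identity = solve-∀

  -- 27 Σ_{m < J_k} Y_m = (6k − 2) 2^k + (6k + 2) (−1)^k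
  M₁form : ℕ → ℤ
  M₁form k = (+ 6 * + k - + 2) * pow2 k + (+ 6 * + k + + 2) * sign k

  first-moment-closed : ∀ {f : ℕ → ℕ} → f 0 ≡ 0 → f 1 ≡ 0 →
    (∀ k → f (suc (suc k)) ≡ f (suc k) ℕ.+ 2 ℕ.* f k ℕ.+ 2 ℕ.* J k) → ∀ k → + 27 * + f k ≡ M₁form k
  first-moment-closed {f} f₀ f₁ rec =
    two-step-unique (scaled (+ 27) {f} {λ k → 2 ℕ.* J k} rec) M₁form-rec
                    (cong (λ t → + 27 * + t) f₀) (cong (λ t → + 27 * + t) f₁)
    where
    source : ∀ k → + 27 * + (2 ℕ.* J k) ≡ + 18 * Jform k
    source k = begin
      + 27 * + (2 ℕ.* J k)   ≡⟨ cong (+ 27 *_) (pos-* 2 (J k)) ⟩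
      + 27 * (+ 2 * + J k)   ≡⟨ regroup (+ J k) ⟩
      + 18 * (+ 3 * + J k)   ≡⟨ cong (+ 18 *_) (J-closed k) ⟩
      + 18 * Jform k         ∎
      where
      regroup : ∀ j → + 27 * (+ 2 * j) ≡ + 18 * (+ 3 * j)
      regroup = solve-∀
    M₁form-rec : TwoStep (λ k → + 27 * + (2 ℕ.* J k)) M₁form
    M₁form-rec k = trans (identity (+ k) (pow2 k) (sign k))
                         (cong (λ t → M₁form (suc k) + + 2 * M₁form k + t) (sym (source k)))
      where
      identity : ∀ n x s →
        (+ 6 * (+ 2 + n) - + 2) * (+ 2 * (+ 2 * x)) + (+ 6 * (+ 2 + n) + + 2) * - (- s)
        ≡ ((+ 6 * (+ 1 + n) - + 2) * (+ 2 * x) + (+ 6 * (+ 1 + n) + + 2) * - s)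
          + + 2 * ((+ 6 * n - + 2) * x + (+ 6 * n + + 2) * s) + + 18 * (+ 2 * x + s)
      identity = solve-∀

  -- 81 Σ_{m < J_k} Y_m² = (6k² + 2) 2^k + (12k² + 6k − 2) (−1)^k
  M₂form : ℕ → ℤ
  M₂form k = (+ 6 * (+ k * + k) + + 2) * pow2 k + (+ 12 * (+ k * + k) + + 6 * + k - + 2) * sign k

  second-moment-closed : ∀ {f₁ f : ℕ → ℕ} → (∀ k → + 27 * + f₁ k ≡ M₁form k) → f 0 ≡ 0 → f 1 ≡ 0 →
    (∀ k → f (suc (suc k)) ≡ f (suc k) ℕ.+ 2 ℕ.* f k ℕ.+ 2 ℕ.* (2 ℕ.* f₁ k ℕ.+ J k)) →
    ∀ k → + 81 * + f k ≡ M₂form k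
  second-moment-closed {f₁} {f} f₁-closed f₀ f₁′ rec =
    two-step-unique (scaled (+ 81) {f} {λ k → 2 ℕ.* (2 ℕ.* f₁ k ℕ.+ J k)} rec) M₂form-rec
                    (cong (λ t → + 81 * + t) f₀) (cong (λ t → + 81 * + t) f₁′)
    where
    source : ∀ k → + 81 * + (2 ℕ.* (2 ℕ.* f₁ k ℕ.+ J k)) ≡ + 12 * M₁form k + + 54 * Jform k
    source k = begin
      + 81 * + (2 ℕ.* (2 ℕ.* f₁ k ℕ.+ J k))
        ≡⟨ cong (+ 81 *_) (trans (pos-* 2 (2 ℕ.* f₁ k ℕ.+ J k))
                                 (cong (λ t → + 2 * (t + + J k)) (pos-* 2 (f₁ k)))) ⟩
      + 81 * (+ 2 * (+ 2 * + f₁ k + + J k))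
        ≡⟨ regroup (+ f₁ k) (+ J k) ⟩
      + 12 * (+ 27 * + f₁ k) + + 54 * (+ 3 * + J k)
        ≡⟨ cong₂ (λ s t → + 12 * s + + 54 * t) (f₁-closed k) (J-closed k) ⟩
      + 12 * M₁form k + + 54 * Jform k ∎
      where
      regroup : ∀ a j → + 81 * (+ 2 * (+ 2 * a + j)) ≡ + 12 * (+ 27 * a) + + 54 * (+ 3 * j)
      regroup = solve-∀
    M₂form-rec : TwoStep (λ k → + 81 * + (2 ℕ.* (2 ℕ.* f₁ k ℕ.+ J k))) M₂form
    M₂form-rec k = trans (identity (+ k) (pow2 k) (sign k))
                         (cong (λ t → M₂form (suc k) + + 2 * M₂form k + t) (sym (source k)))
      where
      identity : ∀ n x s →
        (+ 6 * ((+ 2 + n) * (+ 2 + n)) + + 2) * (+ 2 * (+ 2 * x))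
          + (+ 12 * ((+ 2 + n) * (+ 2 + n)) + + 6 * (+ 2 + n) - + 2) * - (- s)
        ≡ ((+ 6 * ((+ 1 + n) * (+ 1 + n)) + + 2) * (+ 2 * x)
            + (+ 12 * ((+ 1 + n) * (+ 1 + n)) + + 6 * (+ 1 + n) - + 2) * - s)
          + + 2 * ((+ 6 * (n * n) + + 2) * x + (+ 12 * (n * n) + + 6 * n - + 2) * s)
          + (+ 12 * ((+ 6 * n - + 2) * x + (+ 6 * n + + 2) * s) + + 54 * (+ 2 * x + s))
      identity = solve-∀

  sign-cases : ∀ k → sign k ≡ + 1 ⊎ sign k ≡ - + 1
  sign-cases zero = inj₁ refl
  sign-cases (suc k) with sign-cases k
  ... | inj₁ e = inj₂ (cong -_ e)
  ... | inj₂ e = inj₁ (cong -_ e)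

  -- The numerator of σ²_n − (2n/27 + 8/81) over the common denominator 243 L²,
  -- where s₁ and s₂ are the sums of Y and of Y², L the number of terms and t = 2n.
  gap-numerator : ℤ → ℤ → ℤ → ℤ → ℤ
  gap-numerator s₁ s₂ L t = + 243 * (s₂ * L - s₁ * s₁) - (+ 9 * t + + 24) * (L * L)

  -- its value for the integers in [0, J_{n+1}):  −(8 + 4n + (−1)^n 2^n (16 + 32n + 12n²))
  gap-closed-form : ℕ → ℤ
  gap-closed-form n = - (+ 8 + + 4 * + n + sign n * (pow2 n * (+ 16 + + 32 * + n + + 12 * (+ n * + n))))

  -- 9 × the numerator in terms of n, x = 2^n and σ = (−1)^n after inserting the closed
  -- forms at k = n + 1; an identity of polynomials once σ² = 1
  NumeratorIdentity : ℤ → Set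
  NumeratorIdentity σ = ∀ n x →
    let J₃ = + 2 * (+ 2 * x) + - σ
        M₁ = (+ 6 * (+ 1 + n) - + 2) * (+ 2 * x) + (+ 6 * (+ 1 + n) + + 2) * - σ
        M₂ = (+ 6 * ((+ 1 + n) * (+ 1 + n)) + + 2) * (+ 2 * x)
             + (+ 12 * ((+ 1 + n) * (+ 1 + n)) + + 6 * (+ 1 + n) - + 2) * - σ
    in + 9 * (M₂ * J₃) - + 3 * (M₁ * M₁) - (+ 18 * n + + 24) * (J₃ * J₃)
       ≡ + 9 * - (+ 8 + + 4 * n + σ * (x * (+ 16 + + 32 * n + + 12 * (n * n))))

  numerator-identity₊ : NumeratorIdentity (+ 1)
  numerator-identity₊ = solve-∀

  numerator-identity₋ : NumeratorIdentity (- + 1)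
  numerator-identity₋ = solve-∀

  numerator-identity : ∀ n → NumeratorIdentity (sign n)
  numerator-identity n with sign-cases n
  ... | inj₁ σ≡1 = subst NumeratorIdentity (sym σ≡1) numerator-identity₊
  ... | inj₂ σ≡-1 = subst NumeratorIdentity (sym σ≡-1) numerator-identity₋

  gap-closed : ∀ n {m₁ m₂ L : ℕ} → + 3 * + L ≡ Jform (suc n) → + 27 * + m₁ ≡ M₁form (suc n) →
               + 81 * + m₂ ≡ M₂form (suc n) →
               gap-numerator (+ m₁) (+ m₂) (+ L) (+ (2 ℕ.* n)) ≡ gap-closed-form n
  gap-closed n {m₁} {m₂} {L} L-closed m₁-closed m₂-closed = *-cancelˡ-≡ (+ 9) _ _ (begin
    + 9 * gap-numerator (+ m₁) (+ m₂) (+ L) (+ (2 ℕ.* n))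
      ≡⟨ cong (λ t → + 9 * gap-numerator (+ m₁) (+ m₂) (+ L) t) (pos-* 2 n) ⟩
    + 9 * gap-numerator (+ m₁) (+ m₂) (+ L) (+ 2 * + n)
      ≡⟨ regroup (+ m₁) (+ m₂) (+ L) (+ n) ⟩
    combine (+ 27 * + m₁) (+ 81 * + m₂) (+ 3 * + L)
      ≡⟨ cong₂ (combine (+ 27 * + m₁)) m₂-closed L-closed ⟩
    combine (+ 27 * + m₁) (M₂form (suc n)) (Jform (suc n))
      ≡⟨ cong (λ a → combine a (M₂form (suc n)) (Jform (suc n))) m₁-closed ⟩
    combine (M₁form (suc n)) (M₂form (suc n)) (Jform (suc n))
      ≡⟨ numerator-identity n (+ n) (pow2 n) ⟩
    + 9 * gap-closed-form n ∎)
    where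
    combine : ℤ → ℤ → ℤ → ℤ
    combine a b j = + 9 * (b * j) - + 3 * (a * a) - (+ 18 * + n + + 24) * (j * j)
    regroup : ∀ a b l n → + 9 * (+ 243 * (b * l - a * a) - (+ 9 * (+ 2 * n) + + 24) * (l * l))
              ≡ + 9 * ((+ 81 * b) * (+ 3 * l)) - + 3 * ((+ 27 * a) * (+ 27 * a)) - (+ 18 * n + + 24) * ((+ 3 * l) * (+ 3 * l))
    regroup = solve-∀

module Moments (Y : ℕ → ℕ) (Y-zero : Y 0 ≡ 0) (self-similar : KentuckySequence.SelfSimilar Y) where
  open KentuckySequence using (J)
  open RangeSums
  open ClosedForms using (M₁form; M₂form; first-moment-closed; second-moment-closed)
  open import Data.Nat using (suc; _+_; _*_)
  open import Data.Nat.Properties using (+-assoc; *-distribˡ-+)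
  open import Data.Nat.Tactic.RingSolver using (solve-∀)
  import Data.Integer as ℤ
  open import Data.List using (map; length; upTo)
  open import Data.List.Properties using (length-map; length-upTo; map-upTo; map-∘)
  open import Data.Nat.ListAction using (sum)
  open import Data.Product using (_×_; _,_; proj₁; proj₂)
  open import Function using (_∘_; id)
  open import Relation.Binary.PropositionalEquality using (refl; sym; trans; cong; cong₂; module ≡-Reasoning)

  -- [0, J_{k+2}) = [0, J_{k+1}) ∪ (J_{k+1} + [0, J_k)) ∪ (J_{k+1} + J_k + [0, J_k)),
  -- and on each of the last two blocks Y is a shifted copy of Y on [0, J_k)
  block : ∀ (h : ℕ → ℕ) k → Σ< (h ∘ Y) (J (suc (suc k))) ≡ Σ< (h ∘ Y) (J (suc k)) + 2 * Σ< (h ∘ suc ∘ Y) (J k)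
  block h k = begin
    Σ< g (J (suc k) + (J k + (J k + 0)))
      ≡⟨ Σ<-split g (J (suc k)) (J k + (J k + 0)) ⟩
    Σ< g (J (suc k)) + Σ< g₁ (J k + (J k + 0))
      ≡⟨ cong (λ t → Σ< g (J (suc k)) + t) (Σ<-split g₁ (J k) (J k + 0)) ⟩
    Σ< g (J (suc k)) + (Σ< g₁ (J k) + Σ< g₂ (J k + 0))
      ≡⟨ cong (λ t → Σ< g (J (suc k)) + (Σ< g₁ (J k) + t)) (Σ<-split g₂ (J k) 0) ⟩
    Σ< g (J (suc k)) + (Σ< g₁ (J k) + (Σ< g₂ (J k) + 0))
      ≡⟨ cong₂ (λ s t → Σ< g (J (suc k)) + (s + (t + 0)))
               (Σ<-cong (J k) (λ i i< → cong h (proj₁ (self-similar k i i<))))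
               (Σ<-cong (J k) (λ i i< → cong h (proj₂ (self-similar k i i<)))) ⟩
    Σ< g (J (suc k)) + 2 * Σ< (h ∘ suc ∘ Y) (J k) ∎
    where
    open ≡-Reasoning
    g g₁ g₂ : ℕ → ℕ
    g = h ∘ Y
    g₁ i = g (J (suc k) + i)
    g₂ i = g₁ (J k + i)

  m₁ m₂ : ℕ → ℕ
  m₁ k = Σ< Y (J k)
  m₂ k = Σ< (λ i → Y i * Y i) (J k)

  m₁-init : m₁ 0 ≡ 0 × m₁ 1 ≡ 0
  m₁-init = cong (_+ 0) Y-zero , cong (_+ 0) Y-zero

  m₂-init : m₂ 0 ≡ 0 × m₂ 1 ≡ 0
  m₂-init = cong (λ y → y * y + 0) Y-zero , cong (λ y → y * y + 0) Y-zero

  m₁-rec : ∀ k → m₁ (suc (suc k)) ≡ m₁ (suc k) + 2 * m₁ k + 2 * J k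
  m₁-rec k = begin
    m₁ (suc (suc k))                    ≡⟨ block id k ⟩
    m₁ (suc k) + 2 * Σ< (suc ∘ Y) (J k) ≡⟨ cong (λ t → m₁ (suc k) + 2 * t) (Σ<-suc Y (J k)) ⟩
    m₁ (suc k) + 2 * (m₁ k + J k)       ≡⟨ cong (λ t → m₁ (suc k) + t) (*-distribˡ-+ 2 (m₁ k) (J k)) ⟩
    m₁ (suc k) + (2 * m₁ k + 2 * J k)   ≡⟨ +-assoc (m₁ (suc k)) _ _ ⟨
    m₁ (suc k) + 2 * m₁ k + 2 * J k     ∎
    where open ≡-Reasoning

  m₂-rec : ∀ k → m₂ (suc (suc k)) ≡ m₂ (suc k) + 2 * m₂ k + 2 * (2 * m₁ k + J k)
  m₂-rec k = begin
    m₂ (suc (suc k))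
      ≡⟨ block (λ y → y * y) k ⟩
    m₂ (suc k) + 2 * Σ< (λ i → suc (Y i) * suc (Y i)) (J k)
      ≡⟨ cong (λ t → m₂ (suc k) + 2 * t) (Σ<-suc-square Y (J k)) ⟩
    m₂ (suc k) + 2 * (m₂ k + 2 * m₁ k + J k)
      ≡⟨ rearrange (m₂ (suc k)) (m₂ k) (m₁ k) (J k) ⟩
    m₂ (suc k) + 2 * m₂ k + 2 * (2 * m₁ k + J k) ∎
    where
    open ≡-Reasoning
    rearrange : ∀ a b c d → a + 2 * (b + 2 * c + d) ≡ a + 2 * b + 2 * (2 * c + d)
    rearrange = solve-∀

  m₁-closed : ∀ k → ℤ.+ 27 ℤ.* ℤ.+ m₁ k ≡ M₁form k
  m₁-closed = first-moment-closed {m₁} (proj₁ m₁-init) (proj₂ m₁-init) m₁-rec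

  m₂-closed : ∀ k → ℤ.+ 81 ℤ.* ℤ.+ m₂ k ≡ M₂form k
  m₂-closed = second-moment-closed {m₁} {m₂} m₁-closed (proj₁ m₂-init) (proj₂ m₂-init) m₂-rec

  values-length : ∀ k {N} → N ≡ J k → length (map Y (upTo N)) ≡ J k
  values-length k {N} refl = trans (length-map Y (upTo N)) (length-upTo N)

  values-sum : ∀ k {N} → N ≡ J k → sum (map Y (upTo N)) ≡ m₁ k
  values-sum k {N} refl = cong sum (map-upTo Y N)

  values-sum-squares : ∀ k {N} → N ≡ J k → sum (map (λ x → x * x) (map Y (upTo N))) ≡ m₂ k
  values-sum-squares k {N} refl = cong sum (trans (sym (map-∘ (upTo N))) (map-upTo (λ i → Y i * Y i) N))

module NumeratorBound where
  open ClosedForms using (sign; pow2; gap-closed-form)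
  open import Data.Nat using (ℕ; zero; suc; _+_; _*_; _^_; _≤_)
  open import Data.Nat.Properties
  open import Data.Nat.Tactic.RingSolver using (solve-∀)
  open import Data.Integer as ℤ using (+_)
  open import Data.Integer.Properties using (pos-*; ∣-i∣≡∣i∣; ∣i+j∣≤∣i∣+∣j∣; ∣i*j∣≡∣i∣*∣j∣)
  open import Relation.Binary.PropositionalEquality using (_≡_; refl; sym; trans; cong; cong₂)

  -- the gap numerator is −(c + (−1)^n 2^n p) with these natural numbers c and p
  err-const err-poly : ℕ → ℕ
  err-const n = 8 + 4 * n
  err-poly n = 16 + 32 * n + 12 * (n * n)

  pow2-pos : ∀ n → pow2 n ≡ + (2 ^ n)
  pow2-pos zero = refl
  pow2-pos (suc n) = trans (cong (+ 2 ℤ.*_) (pow2-pos n)) (sym (pos-* 2 (2 ^ n)))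

  ∣sign∣ : ∀ n → ℤ.∣ sign n ∣ ≡ 1
  ∣sign∣ zero = refl
  ∣sign∣ (suc n) = trans (∣-i∣≡∣i∣ (sign n)) (∣sign∣ n)

  ∣gap∣≤ : ∀ n → ℤ.∣ gap-closed-form n ∣ ≤ err-const n + 2 ^ n * err-poly n
  ∣gap∣≤ n = begin
    ℤ.∣ ℤ.- (c ℤ.+ sign n ℤ.* (pow2 n ℤ.* p)) ∣      ≡⟨ ∣-i∣≡∣i∣ (c ℤ.+ sign n ℤ.* (pow2 n ℤ.* p)) ⟩
    ℤ.∣ c ℤ.+ sign n ℤ.* (pow2 n ℤ.* p) ∣            ≤⟨ ∣i+j∣≤∣i∣+∣j∣ c (sign n ℤ.* (pow2 n ℤ.* p)) ⟩
    ℤ.∣ c ∣ + ℤ.∣ sign n ℤ.* (pow2 n ℤ.* p) ∣         ≡⟨ cong₂ _+_ ∣c∣ ∣σxp∣ ⟩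
    err-const n + 1 * (2 ^ n * err-poly n)            ≡⟨ cong (λ t → err-const n + t) (*-identityˡ _) ⟩
    err-const n + 2 ^ n * err-poly n                  ∎
    where
    open ≤-Reasoning
    c p : ℤ.ℤ
    c = + 8 ℤ.+ + 4 ℤ.* + n
    p = + 16 ℤ.+ + 32 ℤ.* + n ℤ.+ + 12 ℤ.* (+ n ℤ.* + n)
    ∣c∣ : ℤ.∣ c ∣ ≡ err-const n
    ∣c∣ = cong (λ t → ℤ.∣ + 8 ℤ.+ t ∣) (sym (pos-* 4 n))
    ∣p∣ : ℤ.∣ p ∣ ≡ err-poly n
    ∣p∣ = cong ℤ.∣_∣ (cong₂ (λ s t → + 16 ℤ.+ s ℤ.+ t) (sym (pos-* 32 n))
                            (trans (cong (+ 12 ℤ.*_) (sym (pos-* n n))) (sym (pos-* 12 (n * n)))))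
    ∣σxp∣ : ℤ.∣ sign n ℤ.* (pow2 n ℤ.* p) ∣ ≡ 1 * (2 ^ n * err-poly n)
    ∣σxp∣ = trans (∣i*j∣≡∣i∣*∣j∣ (sign n) _) (cong₂ _*_ (∣sign∣ n)
              (trans (∣i*j∣≡∣i∣*∣j∣ (pow2 n) p) (cong₂ _*_ (cong ℤ.∣_∣ (pow2-pos n)) ∣p∣)))

  err≤ : ∀ n → 1 ≤ n → err-const n + err-poly n ≤ 72 * (n * n)
  err≤ (suc a) _ = ≤-trans (m≤m+n _ (60 * (a * a) + 84 * a)) (≤-reflexive (identity a))
    where
    identity : ∀ a → 8 + 4 * suc a + (16 + 32 * suc a + 12 * (suc a * suc a)) + (60 * (a * a) + 84 * a)
                     ≡ 72 * (suc a * suc a)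
    identity = solve-∀

  gap-bound : ∀ n L → 1 ≤ n → 2 ^ n ≤ L → ℤ.∣ gap-closed-form n ∣ * 2 ^ n ≤ n * n * (243 * L * L)
  gap-bound n L 1≤n x≤L = begin
    ℤ.∣ gap-closed-form n ∣ * x      ≤⟨ *-monoˡ-≤ x (∣gap∣≤ n) ⟩
    (c + x * p) * x                  ≤⟨ *-monoˡ-≤ x (+-monoˡ-≤ (x * p) (m≤n*m c x {{m^n≢0 2 n}})) ⟩
    (x * c + x * p) * x              ≡⟨ cong (_* x) (*-distribˡ-+ x c p) ⟨
    x * (c + p) * x                  ≤⟨ *-monoˡ-≤ x (*-monoʳ-≤ x (err≤ n 1≤n)) ⟩
    x * (72 * (n * n)) * x           ≡⟨ regroup x (n * n) ⟩
    72 * (n * n) * (x * x)           ≤⟨ *-mono-≤ (*-monoˡ-≤ (n * n) (m≤m+n 72 171)) (*-mono-≤ x≤L x≤L) ⟩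
    243 * (n * n) * (L * L)          ≡⟨ regroup′ (n * n) L ⟩
    n * n * (243 * L * L)            ∎
    where
    open ≤-Reasoning
    x c p : ℕ
    x = 2 ^ n
    c = err-const n
    p = err-poly n
    regroup : ∀ x m → x * (72 * m) * x ≡ 72 * m * (x * x)
    regroup = solve-∀
    regroup′ : ∀ m L → 243 * m * (L * L) ≡ m * (243 * L * L)
    regroup′ = solve-∀

-- Computations are done in ℚᵘ, where numerators and
-- denominators of sums and products of explicit fractions are explicit.
module VarianceFraction where
  open import Defs using (ℕ→ℚ; _÷_; mean; variance)
  open ClosedForms using (gap-numerator)
  open import Data.Nat using (ℕ; suc; _+_; _*_; _^_; _≤_; z≤n; s≤s; pred)
  open import Data.Nat.Properties using (m^n≢0; suc-pred)
  open import Data.Integer as ℤ using (ℤ; +_)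
  open import Data.Integer.Properties using (pos-*)
  open import Data.Integer.Tactic.RingSolver using (solve-∀)
  open import Data.Rational as ℚ using (ℚ; _/_; 1ℚ; toℚᵘ)
  import Data.Rational.Properties as ℚP
  open import Data.Rational.Unnormalised as ℚᵘ using (ℚᵘ; mkℚᵘ; _≃_; *≡*; *≤*)
  import Data.Rational.Unnormalised.Properties as ℚᵘP
  open import Data.List using (map; length)
  open import Data.List.Properties using (length-map)
  open import Data.Nat.ListAction using (sum)
  open import Relation.Binary.PropositionalEquality using (_≡_; refl; sym; trans; cong₂; subst; subst₂)

  frac : ℕ → ℕ → ℚᵘ
  frac s l = mkℚᵘ (+ s) 0 ℚᵘ.* mkℚᵘ (+ 1) l

  toℚᵘ-homo-− : ∀ p q → toℚᵘ (p ℚ.- q) ≃ toℚᵘ p ℚᵘ.- toℚᵘ q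
  toℚᵘ-homo-− p q =
    ℚᵘP.≃-trans (ℚP.toℚᵘ-homo-+ p (ℚ.- q)) (ℚᵘP.+-cong (ℚᵘP.≃-refl {toℚᵘ p}) (ℚP.toℚᵘ-homo‿- q))

  mean-fraction : ∀ xs {s l} → sum xs ≡ s → length xs ≡ suc l → toℚᵘ (mean xs) ≃ frac s l
  mean-fraction xs {s} {l} sum≡ len≡ =
    subst (λ q → toℚᵘ q ≃ frac s l) (sym (cong₂ (λ s n → ℕ→ℚ s ÷ n) sum≡ len≡))
      (ℚᵘP.≃-trans (ℚP.toℚᵘ-homo-* (ℕ→ℚ s) ((+ 1) / suc l))
        (ℚᵘP.*-cong (ℚP.toℚᵘ-fromℚᵘ (mkℚᵘ (+ s) 0)) (ℚP.toℚᵘ-fromℚᵘ (mkℚᵘ (+ 1) l))))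

  variance-fraction : ∀ xs {s₁ s₂ l} → length xs ≡ suc l → sum xs ≡ s₁ → sum (map (λ x → x * x) xs) ≡ s₂ →
                      toℚᵘ (variance xs) ≃ frac s₂ l ℚᵘ.- frac s₁ l ℚᵘ.* frac s₁ l
  variance-fraction xs len sum₁ sum₂ =
    ℚᵘP.≃-trans (toℚᵘ-homo-− (mean (map (λ x → x * x) xs)) (mean xs ℚ.* mean xs))
    (ℚᵘP.+-cong (mean-fraction (map (λ x → x * x) xs) sum₂ (trans (length-map _ xs) len))
                (ℚᵘP.-‿cong (ℚᵘP.≃-trans (ℚP.toℚᵘ-homo-* (mean xs) (mean xs))
                                        (ℚᵘP.*-cong (mean-fraction xs sum₁ len) (mean-fraction xs sum₁ len)))))

  target-fraction : ∀ t → toℚᵘ ((+ t) / 27 ℚ.+ (+ 8) / 81) ≃ mkℚᵘ (+ t) 26 ℚᵘ.+ mkℚᵘ (+ 8) 80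
  target-fraction t = ℚᵘP.≃-trans (ℚP.toℚᵘ-homo-+ ((+ t) / 27) ((+ 8) / 81))
    (ℚᵘP.+-cong (ℚP.toℚᵘ-fromℚᵘ (mkℚᵘ (+ t) 26)) (ℚP.toℚᵘ-fromℚᵘ (mkℚᵘ (+ 8) 80)))

  gap-fraction : ∀ s₁ s₂ l t →
    (frac s₂ l ℚᵘ.- frac s₁ l ℚᵘ.* frac s₁ l) ℚᵘ.- (mkℚᵘ t 26 ℚᵘ.+ mkℚᵘ (+ 8) 80)
    ≃ mkℚᵘ (gap-numerator (+ s₁) (+ s₂) (+ suc l) t) (pred (243 * suc l * suc l))
  gap-fraction s₁ s₂ l t = *≡* (cross-multiplied (+ s₁) (+ s₂) (+ suc l) t)
    where
    -- numerator and denominator of the left side as ℚᵘ's _+_ and _*_ compute them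
    cross-multiplied : ∀ a b L t →
      ((b ℤ.* + 1 ℤ.* ((+ 1 ℤ.* L) ℤ.* (+ 1 ℤ.* L)) ℤ.+ ℤ.- (a ℤ.* + 1 ℤ.* (a ℤ.* + 1)) ℤ.* (+ 1 ℤ.* L))
         ℤ.* (+ 27 ℤ.* + 81)
       ℤ.+ ℤ.- (t ℤ.* + 81 ℤ.+ + 8 ℤ.* + 27) ℤ.* ((+ 1 ℤ.* L) ℤ.* ((+ 1 ℤ.* L) ℤ.* (+ 1 ℤ.* L))))
      ℤ.* (+ 243 ℤ.* L ℤ.* L)
      ≡ (+ 243 ℤ.* (b ℤ.* L ℤ.- a ℤ.* a) ℤ.- (+ 9 ℤ.* t ℤ.+ + 24) ℤ.* (L ℤ.* L))
        ℤ.* ((+ 1 ℤ.* L) ℤ.* ((+ 1 ℤ.* L) ℤ.* (+ 1 ℤ.* L)) ℤ.* (+ 27 ℤ.* + 81))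
    cross-multiplied = solve-∀

  fraction-bound : ∀ {E d B b} → ℤ.∣ E ∣ * suc b ≤ B * suc d → ℚᵘ.∣ mkℚᵘ E d ∣ ℚᵘ.≤ mkℚᵘ (+ B) b
  fraction-bound {E} {d} {B} {b} h = *≤* (subst₂ ℤ._≤_ (pos-* ℤ.∣ E ∣ (suc b)) (pos-* B (suc d)) (ℤ.+≤+ h))

  variance-gap-bound : ∀ xs n {s₁ s₂ L} → 1 ≤ L → length xs ≡ L → sum xs ≡ s₁ →
    sum (map (λ x → x * x) xs) ≡ s₂ →
    ℤ.∣ gap-numerator (+ s₁) (+ s₂) (+ L) (+ (2 * n)) ∣ * 2 ^ n ≤ n * n * (243 * L * L) →
    ℚ.∣ variance xs ℚ.- ((+ (2 * n)) / 27 ℚ.+ (+ 8) / 81) ∣ ℚ.≤ 1ℚ ℚ.* (_/_ (+ (n * n)) (2 ^ n) {{m^n≢0 2 n}})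
  variance-gap-bound xs n {s₁} {s₂} {suc l} (s≤s z≤n) len sum₁ sum₂ bound =
    ℚP.toℚᵘ-cancel-≤ (ℚᵘP.≤-respʳ-≃ bound≃ (ℚᵘP.≤-respˡ-≃ gap≃ (fraction-bound {E} bound′)))
    where
    V M B : ℚ
    V = variance xs
    M = (+ (2 * n)) / 27 ℚ.+ (+ 8) / 81
    B = _/_ (+ (n * n)) (2 ^ n) {{m^n≢0 2 n}}
    b : ℕ
    b = pred (2 ^ n)
    2^n≡ : 2 ^ n ≡ suc b
    2^n≡ = sym (suc-pred (2 ^ n) {{m^n≢0 2 n}})
    E : ℤ
    E = gap-numerator (+ s₁) (+ s₂) (+ suc l) (+ (2 * n))
    bound′ : ℤ.∣ E ∣ * suc b ≤ n * n * (243 * suc l * suc l)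
    bound′ = subst (λ x → ℤ.∣ E ∣ * x ≤ n * n * (243 * suc l * suc l)) 2^n≡ bound
    gap≃ : ℚᵘ.∣ mkℚᵘ E (pred (243 * suc l * suc l)) ∣ ≃ toℚᵘ (ℚ.∣ V ℚ.- M ∣)
    gap≃ = ℚᵘP.≃-sym (ℚᵘP.≃-trans (ℚP.toℚᵘ-homo-∣-∣ (V ℚ.- M)) (ℚᵘP.∣-∣-cong
             (ℚᵘP.≃-trans (toℚᵘ-homo-− V M)
               (ℚᵘP.≃-trans (ℚᵘP.+-cong (variance-fraction xs len sum₁ sum₂) (ℚᵘP.-‿cong (target-fraction (2 * n))))
                            (gap-fraction s₁ s₂ l (+ (2 * n)))))))
    bound≃ : mkℚᵘ (+ (n * n)) b ≃ toℚᵘ (1ℚ ℚ.* B)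
    bound≃ = ℚᵘP.≃-sym (subst (λ q → toℚᵘ q ≃ mkℚᵘ (+ (n * n)) b)
               (sym (trans (ℚP.*-identityˡ B)
                           (ℚP./-cong {+ (n * n)} {2 ^ n} {+ (n * n)} {suc b} {{m^n≢0 2 n}} refl 2^n≡)))
               (ℚP.toℚᵘ-fromℚᵘ (mkℚᵘ (+ (n * n)) b)))


open import Defs
open import Data.Nat using (ℕ; _*_; _^_; _≤_)
open import Data.Nat.Properties using (m^n≢0)
open import Data.Integer using (+_)
open import Data.Rational using (ℚ; _/_; ∣_∣; _-_; _+_) renaming (_*_ to _*ℚ_; _≤_ to _≤ℚ_)
open import Data.Product using (∃; _,_)

open import Data.Nat using (suc)
import Data.Integer as ℤ
open import Data.Rational using (1ℚ)
open import Data.List using (map; upTo)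
open import Relation.Binary.PropositionalEquality using (sym; subst)
open KentuckySequence using (J; J-pos; J-lower)
open ClosedForms using (gap-numerator; gap-closed-form; gap-closed; J-closed)
open NumeratorBound using (gap-bound)
open VarianceFraction using (variance-gap-bound)

proposition3p2 : (a : ℕ → ℕ) → IsKentucky2 a →
    (Y : ℕ → ℕ) → (∀ m → NumSummands a m (Y m)) →
    ∃ λ (C : ℚ) → ∃ λ (N₀ : ℕ) → ∀ n → N₀ ≤ n →
      ∣ sigma2 a Y n - ((+ (2 * n)) / 27 + (+ 8) / 81) ∣
        ≤ℚ C *ℚ (_/_ (+ (n * n)) (2 ^ n) {{m^n≢0 2 n}})
proposition3p2 a K Y hY = 1ℚ , 1 , bound
  where
  open SummandCounts a K Y hY using (Y-zero; Y-self-similar; a-first)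
  open Moments Y Y-zero Y-self-similar
    using (m₁; m₂; m₁-closed; m₂-closed; values-length; values-sum; values-sum-squares)

  numerator : ∀ n → gap-numerator (+ m₁ (suc n)) (+ m₂ (suc n)) (+ J (suc n)) (+ (2 * n)) ≡ gap-closed-form n
  numerator n = gap-closed n {m₁ (suc n)} {m₂ (suc n)} {J (suc n)}
                           (J-closed (suc n)) (m₁-closed (suc n)) (m₂-closed (suc n))

  numerator-bound : ∀ n → 1 ≤ n →
    ℤ.∣ gap-numerator (+ m₁ (suc n)) (+ m₂ (suc n)) (+ J (suc n)) (+ (2 * n)) ∣ * 2 ^ n
      ≤ n * n * (243 * J (suc n) * J (suc n))
  numerator-bound n 1≤n = subst (λ E → ℤ.∣ E ∣ * 2 ^ n ≤ n * n * (243 * J (suc n) * J (suc n)))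
    (sym (numerator n)) (gap-bound n (J (suc n)) 1≤n (J-lower n))

  bound : ∀ n → 1 ≤ n →
    ∣ sigma2 a Y n - ((+ (2 * n)) / 27 + (+ 8) / 81) ∣ ≤ℚ 1ℚ *ℚ (_/_ (+ (n * n)) (2 ^ n) {{m^n≢0 2 n}})
  bound n 1≤n = variance-gap-bound (map Y (upTo (a (suc (2 * n))))) n {m₁ (suc n)} {m₂ (suc n)} (J-pos (suc n))
    (values-length (suc n) (a-first n)) (values-sum (suc n) (a-first n))
    (values-sum-squares (suc n) (a-first n)) (numerator-bound n 1≤n)
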